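{- Let $D$ and $L$ be distributive $0$-lattices with $D$ finite, let $\varphi\colon D\to L$ be a $0$-lattice homomorphism, let $a,b\in D$ and $c\in L$. Then $\varphi(a)\le\varphi(b)\vee c$ if and only if $\varphi(p)\le\varphi(p_*)\vee c$ for every join-irreducible element $p$ of $D$ with $p\le a$ and $p\not\le b$.
   Context: For a (nonzero) join-irreducible element $p$ of the finite distributive lattice $D$, $p_*$ denotes its unique lower cover. -}

module Defs where

open import Level using (Level; _⊔_; suc)
open import Data.Nat using (ℕ)
open import Data.Fin using (Fin)
open import Data.Product using (Σ; _×_)
open import Data.Sum using (_⊎_)
open import Relation.Nullary using (¬_)
open import Relation.Binary.PropositionalEquality as ≡ using (_≡_)
open import Function.Bundles using (Bijection)
open import Algebra.Lattice.Bundles using (DistributiveLattice)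
open import Algebra.Lattice.Morphism.Structures using (module LatticeMorphisms)

record Distributive0Lattice (c ℓ : Level) : Set (suc (c ⊔ ℓ)) where
  field
    distributiveLattice : DistributiveLattice c ℓ

  open DistributiveLattice distributiveLattice public

  field
    𝟘          : Carrier
    𝟘-identity : ∀ x → (𝟘 ∨ x) ≈ x

  infix 4 _≤_ _<_
  _≤_ : Carrier → Carrier → Set ℓ
  x ≤ y = (x ∨ y) ≈ y

  _<_ : Carrier → Carrier → Set ℓ
  x < y = x ≤ y × ¬ (x ≈ y)

  JoinIrreducible : Carrier → Set (c ⊔ ℓ)
  JoinIrreducible p = ¬ (p ≈ 𝟘) × (∀ x y → p ≈ (x ∨ y) → p ≈ x ⊎ p ≈ y)

  IsLowerCover : Carrier → Carrier → Set (c ⊔ ℓ)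
  IsLowerCover q p = q < p × (∀ z → q < z → ¬ (z < p))

Finite : ∀ {c ℓ} → Distributive0Lattice c ℓ → Set (c ⊔ ℓ)
Finite D = Σ ℕ λ n → Bijection (≡.setoid (Fin n)) setoid
  where open Distributive0Lattice D

Is0LatticeHomomorphism : ∀ {c₁ ℓ₁ c₂ ℓ₂} (D : Distributive0Lattice c₁ ℓ₁) (L : Distributive0Lattice c₂ ℓ₂) →
                         (Distributive0Lattice.Carrier D → Distributive0Lattice.Carrier L) → Set (c₁ ⊔ ℓ₁ ⊔ ℓ₂)
Is0LatticeHomomorphism D L φ =
  LatticeMorphisms.IsLatticeHomomorphism (D.rawLattice) (L.rawLattice) φ × (φ D.𝟘 L.≈ L.𝟘)
  where module D = Distributive0Lattice D
        module L = Distributive0Lattice L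

{-# OPTIONS --safe #-}
-- If p is join-irreducible with lower cover pₗ and p ≰ b, then p ∧ b ≤ pₗ; so when
-- φ p ≤ φ b ∨ c, distributivity of L gives φ p ≤ (φ p ∧ φ b) ∨ c ≤ φ pₗ ∨ c.
-- Conversely, show φ x ≤ φ b ∨ c for every x ≤ a by well-founded induction on the finite
-- lattice D: x = 0 and x ≤ b are immediate, a join x = y ∨ z of strictly smaller elements
-- follows from y and z, and a join-irreducible x ≰ b is bounded through its lower cover.
module Submission where

open import Defs
open import Level using (Level; _⊔_)
open import Algebra.Lattice.Morphism.Structures using (module LatticeMorphisms)
open import Data.Empty using (⊥-elim)
open import Data.Nat using (zero; suc)
open import Data.Fin using (zero; suc)
import Data.Fin.Properties as Fin
open import Data.Fin.Induction using (spo-wellFounded)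
open import Data.Product using (∃; _×_; _,_; proj₁; proj₂)
open import Data.Sum using (_⊎_; inj₁; inj₂)
open import Data.Vec.Functional using (Vector; foldr; tail)
open import Function.Base using (_∘_)
open import Function.Bundles using (_⇔_; mk⇔; Inverse)
open import Function.Construct.Symmetry using (inverse)
open import Function.Properties.Bijection using (Bijection⇒Inverse)
open import Function.Properties.Inverse using (Inverse⇒Injection)
open import Induction.WellFounded using (WellFounded; module Subrelation; module All)
open import Relation.Binary.Definitions using (Decidable)
import Relation.Binary.Construct.On as On
import Relation.Binary.Lattice as R
import Relation.Binary.Properties.Poset as PosetProperties
import Relation.Binary.Lattice.Properties.JoinSemilattice as JoinSemilatticeProperties
open import Relation.Nullary using (¬_; Dec; yes; no; ¬?; _×-dec_)
open import Relation.Nullary.Decidable using (via-injection)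

module LatticeOrder {c ℓ} (D : Distributive0Lattice c ℓ) where
  open Distributive0Lattice D
  open import Algebra.Lattice.Properties.Lattice lattice using (∨-∧-orderTheoreticLattice)
  private module O = R.Lattice ∨-∧-orderTheoreticLattice

  -- The library's order-theoretic lattice orders by x ≈ x ∧ y; it is transported to the
  -- order x ∨ y ≈ y of Distributive0Lattice.

  private
    ≤⇒≤ᴼ : ∀ {x y} → x ≤ y → x O.≤ y
    ≤⇒≤ᴼ {x} {y} x∨y≈y = begin
      x            ≈⟨ ∧-absorbs-∨ x y ⟨
      x ∧ (x ∨ y)  ≈⟨ ∧-congˡ x∨y≈y ⟩
      x ∧ y        ∎
      where open import Relation.Binary.Reasoning.Setoid setoid

    ≤ᴼ⇒≤ : ∀ {x y} → x O.≤ y → x ≤ y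
    ≤ᴼ⇒≤ {x} {y} x≈x∧y = begin
      x ∨ y        ≈⟨ ∨-congʳ x≈x∧y ⟩
      x ∧ y ∨ y    ≈⟨ ∨-comm (x ∧ y) y ⟩
      y ∨ x ∧ y    ≈⟨ ∨-congˡ (∧-comm x y) ⟩
      y ∨ y ∧ x    ≈⟨ ∨-absorbs-∧ y x ⟩
      y            ∎
      where open import Relation.Binary.Reasoning.Setoid setoid

  isOrderTheoreticLattice : R.IsLattice _≈_ _≤_ _∨_ _∧_
  isOrderTheoreticLattice = record
    { isPartialOrder = record
      { isPreorder = record
        { isEquivalence = isEquivalence
        ; reflexive     = ≤ᴼ⇒≤ ∘ O.reflexive
        ; trans         = λ x≤y y≤z → ≤ᴼ⇒≤ (O.trans (≤⇒≤ᴼ x≤y) (≤⇒≤ᴼ y≤z))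
        }
      ; antisym = λ x≤y y≤x → O.antisym (≤⇒≤ᴼ x≤y) (≤⇒≤ᴼ y≤x)
      }
    ; supremum = λ x y → ≤ᴼ⇒≤ (O.x≤x∨y x y) , ≤ᴼ⇒≤ (O.y≤x∨y x y) ,
                         λ _ x≤z y≤z → ≤ᴼ⇒≤ (O.∨-least (≤⇒≤ᴼ x≤z) (≤⇒≤ᴼ y≤z))
    ; infimum  = λ x y → ≤ᴼ⇒≤ (O.x∧y≤x x y) , ≤ᴼ⇒≤ (O.x∧y≤y x y) ,
                         λ _ z≤x z≤y → ≤ᴼ⇒≤ (O.∧-greatest (≤⇒≤ᴼ z≤x) (≤⇒≤ᴼ z≤y))
    }

  orderTheoreticLattice : R.Lattice c ℓ ℓ
  orderTheoreticLattice = record { isLattice = isOrderTheoreticLattice }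

  open R.Lattice orderTheoreticLattice public
    using (poset; joinSemilattice; x≤x∨y; y≤x∨y; ∨-least; x∧y≤x; x∧y≤y; ∧-greatest;
           ≤-respˡ-≈)
    renaming (refl to ≤-refl; reflexive to ≤-reflexive; trans to ≤-trans)
  open PosetProperties poset public
    using (<-isStrictPartialOrder; <-respˡ-≈; <-respʳ-≈; <⇒≉; <⇒≱; ≤∧≉⇒<)
  open JoinSemilatticeProperties joinSemilattice public using (∨-monotonic)

  ≤∨⇒≤∧∨ : ∀ {x y z} → x ≤ y ∨ z → x ≤ (x ∧ y) ∨ z
  ≤∨⇒≤∧∨ {x} {y} {z} x≤y∨z = begin
    x                ≤⟨ ∧-greatest ≤-refl x≤y∨z ⟩
    x ∧ (y ∨ z)      ≈⟨ ∧-distribˡ-∨ x y z ⟩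
    x ∧ y ∨ x ∧ z    ≤⟨ ∨-monotonic ≤-refl (x∧y≤y x z) ⟩
    x ∧ y ∨ z        ∎
    where open import Relation.Binary.Reasoning.PartialOrder poset

module JoinIrreducibility {c ℓ} (D : Distributive0Lattice c ℓ) where
  open Distributive0Lattice D
  open LatticeOrder D

  ⋁ : ∀ {n} → Vector Carrier n → Carrier
  ⋁ = foldr _∨_ 𝟘

  ⋁-upper : ∀ {n} (g : Vector Carrier n) i → g i ≤ ⋁ g
  ⋁-upper g zero    = x≤x∨y _ _
  ⋁-upper g (suc i) = ≤-trans (⋁-upper (tail g) i) (y≤x∨y _ _)

  ⋁-least : ∀ {n} {g : Vector Carrier n} {x} → (∀ i → g i ≤ x) → ⋁ g ≤ x
  ⋁-least {zero}  _   = 𝟘-identity _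
  ⋁-least {suc n} g≤x = ∨-least (g≤x zero) (⋁-least (g≤x ∘ suc))

  JoinIrreducible-≈⋁ : ∀ {p} → JoinIrreducible p → ∀ {n} (g : Vector Carrier n) →
                       p ≈ ⋁ g → ∃ λ i → p ≈ g i
  JoinIrreducible-≈⋁ (p≉𝟘 , _) {zero} g p≈𝟘 = ⊥-elim (p≉𝟘 p≈𝟘)
  JoinIrreducible-≈⋁ ji@(_ , irreducibleJoin) {suc n} g p≈⋁g with irreducibleJoin _ _ p≈⋁g
  ... | inj₁ p≈g₀    = zero , p≈g₀
  ... | inj₂ p≈⋁tail = let i , p≈gᵢ = JoinIrreducible-≈⋁ ji (tail g) p≈⋁tail in suc i , p≈gᵢ

  joinand-< : ∀ {x y z} → x ≈ y ∨ z → ¬ x ≈ y → y < x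
  joinand-< {x} {y} {z} x≈y∨z x≉y = ≤∧≉⇒< (≤-trans (x≤x∨y y z) (≤-reflexive (sym x≈y∨z))) (x≉y ∘ sym)

  data JoinShape (x : Carrier) : Set (c ⊔ ℓ) where
    bottom      : x ≈ 𝟘 → JoinShape x
    irreducible : JoinIrreducible x → JoinShape x
    reducible   : ∀ {y z} → y < x → z < x → x ≈ y ∨ z → JoinShape x

  -- Without decidable equality the covering property only yields ¬ ¬ (q ≈ q ∨ p ∧ b).
  ∧≤lowerCover : Decidable _≈_ → ∀ {p q b} → JoinIrreducible p → IsLowerCover q p → ¬ p ≤ b →
                 p ∧ b ≤ q
  ∧≤lowerCover _≟_ {p} {q} {b} (_ , irreducibleJoin) ((q≤p , q≉p) , covers) p≰b with q ≟ (q ∨ p ∧ b)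
  ... | yes q≈q∨p∧b = ≤-trans (y≤x∨y q (p ∧ b)) (≤-reflexive (sym q≈q∨p∧b))
  ... | no  q≉q∨p∧b = ⊥-elim (covers (q ∨ p ∧ b) (x≤x∨y q (p ∧ b) , q≉q∨p∧b)
                                       (∨-least q≤p (x∧y≤x p b) , q∨p∧b≉p))
    where
    q∨p∧b≉p : ¬ q ∨ p ∧ b ≈ p
    q∨p∧b≉p q∨p∧b≈p with irreducibleJoin q (p ∧ b) (sym q∨p∧b≈p)
    ... | inj₁ p≈q   = q≉p (sym p≈q)
    ... | inj₂ p≈p∧b = p≰b (≤-trans (≤-reflexive p≈p∧b) (x∧y≤y p b))

module FiniteLattice {c ℓ} (D : Distributive0Lattice c ℓ) (finite : Finite D) where
  open Distributive0Lattice D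
  open LatticeOrder D
  open JoinIrreducibility D

  private
    enumeration = Bijection⇒Inverse (proj₂ finite)
    open Inverse enumeration using (to; from; strictlyInverseˡ)

  infix 4 _≟_ _≤?_ _<?_

  _≟_ : Decidable _≈_
  _≟_ = via-injection (Inverse⇒Injection (inverse enumeration)) Fin._≟_

  _≤?_ : Decidable _≤_
  x ≤? y = x ∨ y ≟ y

  _<?_ : Decidable _<_
  x <? y = (x ≤? y) ×-dec ¬? (x ≟ y)

  <-wellFounded : WellFounded _<_
  <-wellFounded = Subrelation.wellFounded <⇒<-enumerated
    (On.wellFounded from (spo-wellFounded (On.isStrictPartialOrder to <-isStrictPartialOrder)))
    where
    <⇒<-enumerated : ∀ {x y} → x < y → to (from x) < to (from y)
    <⇒<-enumerated {x} {y} x<y =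
      <-respˡ-≈ (sym (strictlyInverseˡ x)) (<-respʳ-≈ (sym (strictlyInverseˡ y)) x<y)

  private
    Splits : Carrier → Carrier → Carrier → Set ℓ
    Splits x y z = x ≈ y ∨ z × ¬ x ≈ y × ¬ x ≈ z

    splits? : ∀ x y z → Dec (Splits x y z)
    splits? x y z = (x ≟ y ∨ z) ×-dec ¬? (x ≟ y) ×-dec ¬? (x ≟ z)

  joinShape : ∀ x → JoinShape x
  joinShape x with x ≟ 𝟘
  ... | yes x≈𝟘 = bottom x≈𝟘
  ... | no  x≉𝟘 with Fin.any? (λ i → Fin.any? (λ j → splits? x (to i) (to j)))
  ...   | yes (_ , _ , x≈y∨z , x≉y , x≉z) =
            reducible (joinand-< x≈y∨z x≉y) (joinand-< (trans x≈y∨z (∨-comm _ _)) x≉z) x≈y∨z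
  ...   | no  ¬splits = irreducible (x≉𝟘 , irreducibleJoin)
    where
    irreducibleJoin : ∀ y z → x ≈ y ∨ z → x ≈ y ⊎ x ≈ z
    irreducibleJoin y z x≈y∨z with x ≟ y | x ≟ z
    ... | yes x≈y | _       = inj₁ x≈y
    ... | no  _   | yes x≈z = inj₂ x≈z
    ... | no  x≉y | no  x≉z = ⊥-elim (¬splits (from y , from z ,
          trans x≈y∨z (∨-cong (sym (strictlyInverseˡ y)) (sym (strictlyInverseˡ z))) ,
          (λ x≈y′ → x≉y (trans x≈y′ (strictlyInverseˡ y))) ,
          (λ x≈z′ → x≉z (trans x≈z′ (strictlyInverseˡ z)))))

  private
    strictlyBelow : Carrier → Carrier → Carrier
    strictlyBelow p u with u <? p
    ... | yes _ = u
    ... | no  _ = 𝟘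

    strictlyBelow-< : ∀ {p} → ¬ p ≈ 𝟘 → ∀ u → strictlyBelow p u < p
    strictlyBelow-< {p} p≉𝟘 u with u <? p
    ... | yes u<p = u<p
    ... | no  _   = 𝟘-identity p , p≉𝟘 ∘ sym

    strictlyBelow-upper : ∀ {p u} → u < p → u ≤ strictlyBelow p u
    strictlyBelow-upper {p} {u} u<p with u <? p
    ... | yes _   = ≤-refl
    ... | no  u≮p = ⊥-elim (u≮p u<p)

  -- The join of all elements strictly below p; join-irreducibility keeps it below p.
  lowerCover : ∀ {p} → JoinIrreducible p → ∃ λ q → IsLowerCover q p
  lowerCover {p} ji@(p≉𝟘 , _) = q , q<p , λ z q<z z<p → <⇒≱ q<z (z≤q z<p)
    where
    below : Vector Carrier (proj₁ finite)
    below = strictlyBelow p ∘ to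

    q = ⋁ below

    q<p : q < p
    q<p = ⋁-least (proj₁ ∘ strictlyBelow-< p≉𝟘 ∘ to) , λ q≈p →
      let i , p≈belowᵢ = JoinIrreducible-≈⋁ ji below (sym q≈p)
      in <⇒≉ (strictlyBelow-< p≉𝟘 (to i)) (sym p≈belowᵢ)

    z≤q : ∀ {z} → z < p → z ≤ q
    z≤q {z} z<p = ≤-respˡ-≈ (strictlyInverseˡ z) (≤-trans
      (strictlyBelow-upper (<-respˡ-≈ (sym (strictlyInverseˡ z)) z<p)) (⋁-upper below (from z)))

module HomomorphismProperties
    {c₁ ℓ₁ c₂ ℓ₂} (D : Distributive0Lattice c₁ ℓ₁) (L : Distributive0Lattice c₂ ℓ₂)
    {φ : Distributive0Lattice.Carrier D → Distributive0Lattice.Carrier L}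
    (hom : Is0LatticeHomomorphism D L φ) where
  private
    module D = Distributive0Lattice D
    module L = Distributive0Lattice L

  open LatticeMorphisms.IsLatticeHomomorphism (proj₁ hom) public
    using (∧-homo; ∨-homo) renaming (⟦⟧-cong to φ-cong)

  φ-𝟘 : φ D.𝟘 L.≈ L.𝟘
  φ-𝟘 = proj₂ hom

  φ-monotone : ∀ {x y} → x D.≤ y → φ x L.≤ φ y
  φ-monotone {x} {y} x∨y≈y = L.trans (L.sym (∨-homo x y)) (φ-cong x∨y≈y)

module _ {c₁ ℓ₁ c₂ ℓ₂} (D : Distributive0Lattice c₁ ℓ₁) (L : Distributive0Lattice c₂ ℓ₂)
         (φ : Distributive0Lattice.Carrier D → Distributive0Lattice.Carrier L)
         (hom : Is0LatticeHomomorphism D L φ)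
         (a b : Distributive0Lattice.Carrier D) (c : Distributive0Lattice.Carrier L) where
  private
    module D where
      open Distributive0Lattice D public
      open LatticeOrder D public
      open JoinIrreducibility D public
  open Distributive0Lattice L
  open LatticeOrder L
  open HomomorphismProperties D L hom

  LowerCoverBounds : Set (c₁ ⊔ ℓ₁ ⊔ ℓ₂)
  LowerCoverBounds = ∀ p → D.JoinIrreducible p → p D.≤ a → ¬ p D.≤ b →
                     ∀ pₗ → D.IsLowerCover pₗ p → φ p ≤ φ pₗ ∨ c

  ≤∨⇒LowerCoverBounds : Decidable D._≈_ → φ a ≤ φ b ∨ c → LowerCoverBounds
  ≤∨⇒LowerCoverBounds _≟_ φa≤φb∨c p ji p≤a p≰b pₗ cover = begin
    φ p              ≤⟨ ≤∨⇒≤∧∨ (≤-trans (φ-monotone p≤a) φa≤φb∨c) ⟩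
    φ p ∧ φ b ∨ c    ≈⟨ ∨-congʳ (∧-homo p b) ⟨
    φ (p D.∧ b) ∨ c  ≤⟨ ∨-monotonic (φ-monotone (D.∧≤lowerCover _≟_ ji cover p≰b)) ≤-refl ⟩
    φ pₗ ∨ c         ∎
    where open import Relation.Binary.Reasoning.PartialOrder poset

  LowerCoverBounds⇒≤∨ : Finite D → LowerCoverBounds → φ a ≤ φ b ∨ c
  LowerCoverBounds⇒≤∨ finite bounds = All.wfRec <-wellFounded _ Bounded step a D.≤-refl
    where
    open FiniteLattice D finite

    Bounded : D.Carrier → Set (ℓ₁ ⊔ ℓ₂)
    Bounded x = x D.≤ a → φ x ≤ φ b ∨ c

    step : ∀ x → (∀ {y} → y D.< x → Bounded y) → Bounded x
    step x boundedBelow x≤a = byShape (joinShape x)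
      where
      ih : ∀ {y} → y D.< x → φ y ≤ φ b ∨ c
      ih y<x = boundedBelow y<x (D.≤-trans (proj₁ y<x) x≤a)

      byShape : D.JoinShape x → φ x ≤ φ b ∨ c
      byShape (D.bottom x≈𝟘) = ≤-respˡ-≈ (sym (trans (φ-cong x≈𝟘) φ-𝟘)) (𝟘-identity _)
      byShape (D.reducible {y} {z} y<x z<x x≈y∨z) =
        ≤-respˡ-≈ (sym (trans (φ-cong x≈y∨z) (∨-homo y z))) (∨-least (ih y<x) (ih z<x))
      byShape (D.irreducible ji) with x ≤? b
      ... | yes x≤b = ≤-trans (φ-monotone x≤b) (x≤x∨y _ _)
      ... | no  x≰b = let q , cover = lowerCover ji in
        ≤-trans (bounds x ji x≤a x≰b q cover) (∨-least (ih (proj₁ cover)) (y≤x∨y _ _))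

lemma2p3 : ∀ {c₁ ℓ₁ c₂ ℓ₂ : Level}
  (D : Distributive0Lattice c₁ ℓ₁) (L : Distributive0Lattice c₂ ℓ₂) →
  Finite D →
  (φ : Distributive0Lattice.Carrier D → Distributive0Lattice.Carrier L) →
  Is0LatticeHomomorphism D L φ →
  (a b : Distributive0Lattice.Carrier D) (c : Distributive0Lattice.Carrier L) →
  let module D = Distributive0Lattice D
      module L = Distributive0Lattice L
  in (φ a L.≤ (φ b L.∨ c))
     ⇔ (∀ p → D.JoinIrreducible p → p D.≤ a → ¬ (p D.≤ b) →
          ∀ pₗ → D.IsLowerCover pₗ p → φ p L.≤ (φ pₗ L.∨ c))
lemma2p3 D L finite φ hom a b c = mk⇔
  (≤∨⇒LowerCoverBounds D L φ hom a b c (FiniteLattice._≟_ D finite))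
  (LowerCoverBounds⇒≤∨ D L φ hom a b c finite)
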